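{- Let $n\in\mathbb{N}$ and $C=(c_1,\dots,c_n)\in\{0,1\}^n$, and set $c_j=0$ for all integers $j\le 0$ and $j\ge n+1$ (zero padding). Then $C$ is a maximal configuration of the Riviera model if and only if none of the following holds for any $i\in\{1,\dots,n\}$: (i) $(c_{i-1},c_i,c_{i+1})=(1,1,1)$; (ii) $(c_{i-1},c_i,c_{i+1})=(0,0,0)$; (iii) $(c_{i-2},c_{i-1},c_i,c_{i+1})=(0,1,0,0)$; (iv) $(c_{i-1},c_i,c_{i+1},c_{i+2})=(0,0,1,0)$. (In the paper's notation: the padded configuration contains none of the decorated substrings $1\underline{1}1$, $0\underline{0}0$, $01\underline{0}0$, $0\underline{0}10$, the underlined letter being aligned with one of $c_1,\dots,c_n$.)
   Context: Riviera model: a configuration of length $n$ is a word $C=(c_1,\dots,c_n)\in\{0,1\}^n$, where $c_i=1$ means lot $i$ of a $1\times n$ strip is occupied by a house and $c_i=0$ means it is empty. Lots outside $\{1,\dots,n\}$ are regarded as empty ($c_j=0$ for $j\le0$ and $j\ge n+1$), so boundary lots receive sunlight from the boundary side. $C$ is permissible if every occupied lot has at least one neighbouring lot empty, i.e.\ there is no $i\in\{1,\dots,n\}$ with $c_{i-1}=c_i=c_{i+1}=1$. $C$ is maximal if it is permissible and, for every $i$ with $c_i=0$, changing $c_i$ to $1$ yields a configuration that is not permissible. -}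

module Defs where

open import Data.Bool using (Bool; true; false)
open import Data.Nat using (ℕ; zero; suc; _<?_)
open import Data.Integer using (ℤ; +_; -[1+_]; _+_; _-_)
open import Data.Fin using (Fin; toℕ; fromℕ<)
open import Data.Vec using (Vec; lookup; _[_]≔_)
open import Data.Product using (_×_)
open import Relation.Binary.PropositionalEquality using (_≡_)
open import Relation.Nullary using (¬_; yes; no)

-- A configuration of length n: c_i = lookup C (i-1) for i ∈ {1,…,n};
-- true = occupied (1), false = empty (0).
Config : ℕ → Set
Config n = Vec Bool n

at : ∀ {n} → Config n → ℤ → Bool
at {n} C -[1+ _ ] = false
at {n} C (+ zero) = false
at {n} C (+ suc k) with k <? n
... | yes k<n = lookup C (fromℕ< k<n)
... | no _    = false

pos : ∀ {n} → Fin n → ℤ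
pos k = + suc (toℕ k)

Permissible : ∀ {n} → Config n → Set
Permissible {n} C = (k : Fin n) →
  ¬ ((at C (pos k - + 1) ≡ true) × (at C (pos k) ≡ true) × (at C (pos k + + 1) ≡ true))

Maximal : ∀ {n} → Config n → Set
Maximal {n} C = Permissible C ×
  ((k : Fin n) → lookup C k ≡ false → ¬ Permissible (C [ k ]≔ true))

Pat1 : ∀ {n} → Config n → Fin n → Set
Pat1 C k = (at C (pos k - + 1) ≡ true) × (at C (pos k) ≡ true) × (at C (pos k + + 1) ≡ true)

Pat2 : ∀ {n} → Config n → Fin n → Set
Pat2 C k = (at C (pos k - + 1) ≡ false) × (at C (pos k) ≡ false) × (at C (pos k + + 1) ≡ false)

Pat3 : ∀ {n} → Config n → Fin n → Set
Pat3 C k = (at C (pos k - + 2) ≡ false) × (at C (pos k - + 1) ≡ true)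
         × (at C (pos k) ≡ false) × (at C (pos k + + 1) ≡ false)

Pat4 : ∀ {n} → Config n → Fin n → Set
Pat4 C k = (at C (pos k - + 1) ≡ false) × (at C (pos k) ≡ false)
         × (at C (pos k + + 1) ≡ true) × (at C (pos k + + 2) ≡ false)

-- A permissible configuration is maximal iff every empty lot i is blocked: occupying
-- it creates a run 111, which must then lie inside c_{i-2} … c_{i+2}, so one of the
-- pairs (c_{i-2}, c_{i-1}), (c_{i-1}, c_{i+1}), (c_{i+1}, c_{i+2}) is (1, 1).  For an
-- empty lot the failure of all three is exactly one of the patterns (ii)–(iv), and
-- pattern (i) is the failure of permissibility.  Runs are compared on the padded
-- configuration viewed as a sequence ℕ → Bool, where no boundary cases arise.
module Submission where

open import Defs
open import Data.Bool using (Bool; true; false)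
open import Data.Nat using (ℕ; zero; suc; _+_; _<?_; _≟_)
open import Data.Nat.Properties using (+-comm; suc-injective; 1+n≢n; m≢1+n+m; m+1+n≢n)
open import Data.Fin using (Fin; toℕ; fromℕ<)
open import Data.Fin.Properties using (toℕ<n; toℕ-fromℕ<; fromℕ<-toℕ)
open import Data.Vec using (lookup; _[_]≔_)
open import Data.Vec.Properties using (lookup∘update; lookup∘update′)
open import Data.Integer using (+_) renaming (_+_ to _+ℤ_; _-_ to _-ℤ_)
open import Data.Sum using (_⊎_; inj₁; inj₂)
open import Data.Product using (_×_; Σ-syntax; _,_)
open import Data.Empty using (⊥-elim)
open import Relation.Nullary using (¬_; yes; no)
open import Relation.Binary.PropositionalEquality
open import Function.Base using (_∘_; id)
open import Function.Bundles using (_⇔_; mk⇔; Equivalence)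

Run3 : (ℕ → Bool) → ℕ → Set
Run3 f m = (f m ≡ true) × (f (suc m) ≡ true) × (f (suc (suc m)) ≡ true)

Runless : (ℕ → Bool) → Set
Runless f = ∀ m → ¬ Run3 f m

Blocked : (a b d e : Bool) → Set
Blocked a b d e = ((a ≡ true) × (b ≡ true)) ⊎ ((b ≡ true) × (d ≡ true)) ⊎ ((d ≡ true) × (e ≡ true))

EmptyLotPattern : (a b c d e : Bool) → Set
EmptyLotPattern a b c d e =
    ((b ≡ false) × (c ≡ false) × (d ≡ false))
  ⊎ ((a ≡ false) × (b ≡ true) × (c ≡ false) × (d ≡ false))
  ⊎ ((b ≡ false) × (c ≡ false) × (d ≡ true) × (e ≡ false))

emptyLotPattern⇒¬blocked : ∀ {a b c d e} → EmptyLotPattern a b c d e → ¬ Blocked a b d e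
emptyLotPattern⇒¬blocked (inj₁ (refl , _ , refl)) (inj₁ (_ , ()))
emptyLotPattern⇒¬blocked (inj₁ (refl , _ , refl)) (inj₂ (inj₁ (() , _)))
emptyLotPattern⇒¬blocked (inj₁ (refl , _ , refl)) (inj₂ (inj₂ (() , _)))
emptyLotPattern⇒¬blocked (inj₂ (inj₁ (refl , refl , _ , refl))) (inj₁ (() , _))
emptyLotPattern⇒¬blocked (inj₂ (inj₁ (refl , refl , _ , refl))) (inj₂ (inj₁ (_ , ())))
emptyLotPattern⇒¬blocked (inj₂ (inj₁ (refl , refl , _ , refl))) (inj₂ (inj₂ (() , _)))
emptyLotPattern⇒¬blocked (inj₂ (inj₂ (refl , _ , refl , refl))) (inj₁ (_ , ()))
emptyLotPattern⇒¬blocked (inj₂ (inj₂ (refl , _ , refl , refl))) (inj₂ (inj₁ (() , _)))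
emptyLotPattern⇒¬blocked (inj₂ (inj₂ (refl , _ , refl , refl))) (inj₂ (inj₂ (_ , ())))

emptyLotPattern⇒empty : ∀ {a b c d e} → EmptyLotPattern a b c d e → c ≡ false
emptyLotPattern⇒empty (inj₁ (_ , c≡0 , _))              = c≡0
emptyLotPattern⇒empty (inj₂ (inj₁ (_ , _ , c≡0 , _)))   = c≡0
emptyLotPattern⇒empty (inj₂ (inj₂ (_ , c≡0 , _ , _)))   = c≡0

¬blocked⇒emptyLotPattern : ∀ a b {c} d e → c ≡ false → ¬ Blocked a b d e → EmptyLotPattern a b c d e
¬blocked⇒emptyLotPattern a     false false e     c≡0 _ = inj₁ (refl , c≡0 , refl)
¬blocked⇒emptyLotPattern a     false true  false c≡0 _ = inj₂ (inj₂ (refl , c≡0 , refl , refl))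
¬blocked⇒emptyLotPattern false true  false e     c≡0 _ = inj₂ (inj₁ (refl , refl , c≡0 , refl))
¬blocked⇒emptyLotPattern a     false true  true  _ ¬blocked = ⊥-elim (¬blocked (inj₂ (inj₂ (refl , refl))))
¬blocked⇒emptyLotPattern a     true  true  e     _ ¬blocked = ⊥-elim (¬blocked (inj₂ (inj₁ (refl , refl))))
¬blocked⇒emptyLotPattern true  true  false e     _ ¬blocked = ⊥-elim (¬blocked (inj₁ (refl , refl)))

module _ {f g : ℕ → Bool} {t : ℕ}
         (agree : ∀ m → m ≢ suc (suc t) → g m ≡ f m) where

  private
    transfer : ∀ {m} → m ≢ suc (suc t) → f m ≡ true → g m ≡ true
    transfer {m} m≢p fm = trans (agree m m≢p) fm

    restrict : ∀ {m} → m ≢ suc (suc t) → g m ≡ true → f m ≡ true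
    restrict {m} m≢p gm = trans (sym (agree m m≢p)) gm

  blocked⇒¬runless : g (suc (suc t)) ≡ true →
    Blocked (f t) (f (suc t)) (f (3 + t)) (f (4 + t)) → ¬ Runless g
  blocked⇒¬runless gp (inj₁ (a , b)) runless =
    runless t (transfer (m≢1+n+m t {1}) a , transfer (m≢1+n+m (suc t) {0}) b , gp)
  blocked⇒¬runless gp (inj₂ (inj₁ (b , d))) runless =
    runless (suc t) (transfer (m≢1+n+m (suc t) {0}) b , gp , transfer 1+n≢n d)
  blocked⇒¬runless gp (inj₂ (inj₂ (d , e))) runless =
    runless (suc (suc t)) (gp , transfer 1+n≢n d , transfer (m+1+n≢n 1) e)

  run⇒blocked : Runless f → ∀ m → Run3 g m →
    Blocked (f t) (f (suc t)) (f (3 + t)) (f (4 + t))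
  run⇒blocked runless m (x , y , z) with m ≟ t | m ≟ suc t | m ≟ suc (suc t)
  ... | yes refl | _ | _ =
    inj₁ (restrict (m≢1+n+m t {1}) x , restrict (m≢1+n+m (suc t) {0}) y)
  ... | no _ | yes refl | _ =
    inj₂ (inj₁ (restrict (m≢1+n+m (suc t) {0}) x , restrict 1+n≢n z))
  ... | no _ | no _ | yes refl =
    inj₂ (inj₂ (restrict 1+n≢n y , restrict (m+1+n≢n 1) z))
  ... | no m≢t | no m≢1+t | no m≢2+t = ⊥-elim (runless m
    ( restrict m≢2+t x
    , restrict (m≢1+t ∘ suc-injective) y
    , restrict (m≢t ∘ suc-injective ∘ suc-injective) z))

-- Index m of the padded sequence holds the lot c_{m-1}, so the five lots
-- c_{i-2}, …, c_{i+2} around lot i = pos k sit at indices toℕ k, …, 4 + toℕ k.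
padded : ∀ {n} → Config n → ℕ → Bool
padded C zero    = false
padded C (suc m) = at C (+ m)

module _ {n} (C : Config n) (k : Fin n) where

  at-pos-2 : at C (pos k -ℤ + 2) ≡ padded C (toℕ k)
  at-pos-2 with toℕ k
  ... | zero  = refl
  ... | suc _ = refl

  at-pos+1 : at C (pos k +ℤ + 1) ≡ padded C (3 + toℕ k)
  at-pos+1 = cong (λ m → at C (+ suc m)) (+-comm (toℕ k) 1)

  at-pos+2 : at C (pos k +ℤ + 2) ≡ padded C (4 + toℕ k)
  at-pos+2 = cong (λ m → at C (+ suc m)) (+-comm (toℕ k) 2)

  at-pos : at C (pos k) ≡ lookup C k
  at-pos with toℕ k <? n
  ... | yes k<n = cong (lookup C) (fromℕ<-toℕ k k<n)
  ... | no k≮n  = ⊥-elim (k≮n (toℕ<n k))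

  pat1⇔run3 : Pat1 C k ⇔ Run3 (padded C) (suc (toℕ k))
  pat1⇔run3 = mk⇔ (λ (x , y , z) → x , y , trans (sym at-pos+1) z)
                  (λ (x , y , z) → x , y , trans at-pos+1 z)

occupied⇒lot : ∀ {n} (C : Config n) t → at C (+ suc t) ≡ true → Σ[ k ∈ Fin n ] toℕ k ≡ t
occupied⇒lot {n} C t occupied with t <? n
... | yes t<n = fromℕ< t<n , toℕ-fromℕ< t<n
... | no _    with () ← occupied

permissible⇔runless : ∀ {n} (C : Config n) → Permissible C ⇔ Runless (padded C)
permissible⇔runless C = mk⇔ permissible⇒runless runless⇒permissible
  where
  permissible⇒runless : Permissible C → Runless (padded C)
  permissible⇒runless _ zero (() , _)
  permissible⇒runless permissible (suc t) run@(_ , occupied , _)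
    with occupied⇒lot C t occupied
  ... | k , refl = permissible k (Equivalence.from (pat1⇔run3 C k) run)

  runless⇒permissible : Runless (padded C) → Permissible C
  runless⇒permissible runless k pat1 = runless (suc (toℕ k)) (Equivalence.to (pat1⇔run3 C k) pat1)

module _ {n} (C : Config n) (k : Fin n) where

  padded-update-self : padded (C [ k ]≔ true) (2 + toℕ k) ≡ true
  padded-update-self = trans (at-pos (C [ k ]≔ true) k) (lookup∘update k C true)

  padded-update-other : ∀ m → m ≢ 2 + toℕ k → padded (C [ k ]≔ true) m ≡ padded C m
  padded-update-other zero          _   = refl
  padded-update-other (suc zero)    _   = refl
  padded-update-other (suc (suc t)) 2+t≢2+k with t <? n
  ... | yes t<n = lookup∘update′ lot≢k C true
    where
    lot≢k : fromℕ< t<n ≢ k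
    lot≢k lot≡k = 2+t≢2+k (cong (suc ∘ suc) (trans (sym (toℕ-fromℕ< t<n)) (cong toℕ lot≡k)))
  ... | no _    = refl

  BlockedAt : Set
  BlockedAt = Blocked (at C (pos k -ℤ + 2)) (at C (pos k -ℤ + 1)) (at C (pos k +ℤ + 1)) (at C (pos k +ℤ + 2))

  blockedAt≡blocked-padded : BlockedAt ≡
    Blocked (padded C (toℕ k)) (padded C (suc (toℕ k))) (padded C (3 + toℕ k)) (padded C (4 + toℕ k))
  blockedAt≡blocked-padded rewrite at-pos-2 C k | at-pos+1 C k | at-pos+2 C k = refl

  blocked⇒¬permissible-update : BlockedAt → ¬ Permissible (C [ k ]≔ true)
  blocked⇒¬permissible-update blocked permissible =
    blocked⇒¬runless padded-update-other padded-update-self (subst id blockedAt≡blocked-padded blocked)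
      (Equivalence.to (permissible⇔runless (C [ k ]≔ true)) permissible)

  ¬blocked⇒permissible-update : Permissible C → ¬ BlockedAt → Permissible (C [ k ]≔ true)
  ¬blocked⇒permissible-update permissible ¬blocked =
    Equivalence.from (permissible⇔runless (C [ k ]≔ true)) λ m run →
      ¬blocked (subst id (sym blockedAt≡blocked-padded)
        (run⇒blocked padded-update-other (Equivalence.to (permissible⇔runless C) permissible) m run))

lemma2p1 : (n : ℕ) (C : Config n) →
    Maximal C ⇔ ((k : Fin n) → ¬ (Pat1 C k ⊎ Pat2 C k ⊎ Pat3 C k ⊎ Pat4 C k))
lemma2p1 n C = mk⇔ maximal⇒patternFree patternFree⇒maximal
  where
  maximal⇒patternFree : Maximal C → (k : Fin n) → ¬ (Pat1 C k ⊎ Pat2 C k ⊎ Pat3 C k ⊎ Pat4 C k)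
  maximal⇒patternFree (permissible , _) k (inj₁ pat1) = permissible k pat1
  maximal⇒patternFree (permissible , maximal) k (inj₂ emptyLot) =
    maximal k (trans (sym (at-pos C k)) (emptyLotPattern⇒empty emptyLot))
      (¬blocked⇒permissible-update C k permissible (emptyLotPattern⇒¬blocked emptyLot))

  patternFree⇒maximal : ((k : Fin n) → ¬ (Pat1 C k ⊎ Pat2 C k ⊎ Pat3 C k ⊎ Pat4 C k)) → Maximal C
  patternFree⇒maximal patternFree = (λ k pat1 → patternFree k (inj₁ pat1)) , maximal
    where
    maximal : (k : Fin n) → lookup C k ≡ false → ¬ Permissible (C [ k ]≔ true)
    maximal k empty permissible′ = patternFree k (inj₂
      (¬blocked⇒emptyLotPattern _ _ _ _ (trans (at-pos C k) empty)
        (λ blocked → blocked⇒¬permissible-update C k blocked permissible′)))
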